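{- Let $\epsilon\ge 0$ and let $D$ be a dendrogram obtained by performing $(1+\epsilon)$-good merges (each $(1+\epsilon)$-good with respect to the graph at the moment it is performed). Let $t$ be a threshold and flatten $D$ with threshold $t$. Then for each returned cluster, every merge used to create it (i.e., every merge in the subtree of $D$ below the corresponding node) has linkage similarity at least $t/(1+\epsilon)$.
   Context: $G=(V,E,w)$ is a finite undirected graph with positive edge weights. For disjoint nonempty $X,Y\subseteq V$, $w(X,Y)=\frac{1}{|X||Y|}\sum_{xy\in E,x\in X,y\in Y}w(xy)$. Given a partition of $V$ into clusters, the contracted graph has the clusters as vertices and an edge of weight $w(X,Y)$ between $X,Y$ iff $w(X,Y)>0$; initially all clusters are singletons; merging adjacent clusters $u,v$ replaces them by $u\cup v$. Min-merge values: $M(v)=\infty$ for singletons, $M(u\cup v)=\min(M(u),M(v),w(u,v))$. $w_{\max}(v)$ is the maximum weight of an edge incident to $v$ in the current graph. A merge of adjacent $u,v$ is $(1+\epsilon)$-good if $\frac{\max(w_{\max}(u),w_{\max}(v))}{\min(M(u),M(v),w(u,v))}\le 1+\epsilon$. The dendrogram of a sequence of merges is the rooted binary forest with singleton leaves and, for each merge of $X,Y$, a node $X\cup Y$ with children $X,Y$; the linkage similarity of such a node is $w(X,Y)$, and that of a leaf is $\infty$. Flattening $D$ with threshold $t$ returns the clusters corresponding to all nodes $d$ of $D$ whose linkage similarity is at least $t$ and all of whose ancestors have linkage similarity less than $t$.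
   Formalization: The edge weights, the parameter ε and the threshold t are rational. -}

module Defs where

open import Data.Nat as ℕ using (ℕ; zero; suc)
open import Data.Integer using (+_)
open import Data.Rational using (ℚ; 0ℚ; 1ℚ; _+_; _*_; _⊔_; _⊓_; _≤_; _<_; _/_)
open import Data.Fin using (Fin)
open import Data.List using (List; []; _∷_; map; foldr; length; concatMap)
open import Data.List.Relation.Binary.Permutation.Propositional using (_↭_)
open import Data.Product using (_×_)
open import Relation.Binary.PropositionalEquality using (_≡_)
open import Relation.Nullary using (¬_)

-- A finite undirected graph on vertex set Fin n with positive edge weights:
-- w i j is the weight of edge ij, and w i j ≡ 0 encodes "no edge".
record WGraph : Set where
  field
    n      : ℕ
    w      : Fin n → Fin n → ℚ
    w-sym  : ∀ i j → w i j ≡ w j i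
    w-nonneg : ∀ i j → 0ℚ ≤ w i j

data ℚ∞ : Set where
  fin : ℚ → ℚ∞
  ∞   : ℚ∞

_⊓∞_ : ℚ∞ → ℚ → ℚ
fin p ⊓∞ q = p ⊓ q
∞     ⊓∞ q = q

_≤∞_ : ℚ → ℚ∞ → Set
p ≤∞ fin q = p ≤ q
p ≤∞ ∞     = Data.Unit.⊤
  where import Data.Unit

module _ (G : WGraph) where
  open WGraph G

  data Tree : Set where
    leaf : Fin n → Tree
    node : Tree → Tree → Tree

  cluster : Tree → List (Fin n)
  cluster (leaf i)   = i ∷ []
  cluster (node l r) = Data.List._++_ (cluster l) (cluster r)
    where import Data.List

  sumℚ : List ℚ → ℚ
  sumℚ = foldr _+_ 0ℚ

  recip : ℕ → ℚ
  recip zero    = 0ℚ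
  recip (suc k) = + 1 / suc k

  wC : List (Fin n) → List (Fin n) → ℚ
  wC X Y = recip (length X ℕ.* length Y)
           * sumℚ (concatMap (λ x → map (λ y → w x y) Y) X)

  wT : Tree → Tree → ℚ
  wT u v = wC (cluster u) (cluster v)

  linkage : Tree → ℚ∞
  linkage (leaf i)   = ∞
  linkage (node l r) = fin (wT l r)

  M : Tree → ℚ∞
  M (leaf i)   = ∞
  M (node l r) = fin ((M l) ⊓∞ ((M r) ⊓∞ (wT l r)))

  -- w_max(u) in the current contracted graph, whose other clusters are `others`
  -- (non-edges have weight 0, and u is adjacent to something whenever this is used)
  wmax : Tree → List Tree → ℚ
  wmax u others = foldr (λ c m → wT u c ⊔ m) 0ℚ others

  -- a merge of u and v in the current graph with clusters u ∷ v ∷ rest is (1+ε)-good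
  -- max(wmax u, wmax v) / min(M u, M v, w(u,v)) ≤ 1+ε   (denominator finite and > 0)
  Good : ℚ → Tree → Tree → List Tree → Set
  Good ε u v rest =
    (wmax u (v ∷ rest) ⊔ wmax v (u ∷ rest))
      ≤ (1ℚ + ε) * ((M u) ⊓∞ ((M v) ⊓∞ (wT u v)))

  singletons : List Tree
  singletons = map leaf (Data.List.allFin n)
    where import Data.List

  -- forests (lists of current clusters = dendrogram roots) reachable from the
  -- singletons by a sequence of (1+ε)-good merges of adjacent clusters
  data GoodRun (ε : ℚ) : List Tree → Set where
    start : GoodRun ε singletons
    merge : ∀ {F} u v rest → GoodRun ε F → F ↭ (u ∷ v ∷ rest)
          → 0ℚ < wT u v → Good ε u v rest
          → GoodRun ε (node u v ∷ rest)

  data _⊑_ : Tree → Tree → Set where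
    ⊑-refl : ∀ {T} → T ⊑ T
    ⊑-l    : ∀ {d l r} → d ⊑ l → d ⊑ node l r
    ⊑-r    : ∀ {d l r} → d ⊑ r → d ⊑ node l r

  -- Flat t T d : d is returned when flattening the tree T at threshold t, i.e.
  -- linkage(d) ≥ t and every ancestor of d (within T) has linkage < t
  data Flat (t : ℚ) : Tree → Tree → Set where
    here  : ∀ {T} → t ≤∞ linkage T → Flat t T T
    left  : ∀ {l r d} → ¬ (t ≤∞ linkage (node l r)) → Flat t l d → Flat t (node l r) d
    right : ∀ {l r d} → ¬ (t ≤∞ linkage (node l r)) → Flat t r d → Flat t (node l r) d

{-# OPTIONS --safe #-}
-- Every (1+ε)-good merge of u and v satisfies w(u,v) ≤ wmax(u) ≤ (1+ε)·M(u ∪ v), so in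
-- every tree of a good run each node's linkage is within a factor 1+ε of its min-merge
-- value; and the min-merge value of a node is at most the linkage of every merge below
-- it. A flattened cluster d has linkage ≥ t, hence every merge (l,r) below it satisfies
-- t ≤ w(d) ≤ (1+ε)·M(d) ≤ (1+ε)·w(l,r).
module Submission where

open import Defs
open import Data.Rational using (ℚ; 0ℚ; 1ℚ; _+_; _*_; _≤_; NonNegative; nonNegative)
open import Data.Rational.Properties
  using (≤-trans; ≤-refl; p⊓q≤p; p⊓q≤q; p≤p⊔q; +-mono-≤; nonNegative⁻¹; *-monoˡ-≤-nonNeg)
open import Data.List using (List)
open import Data.List.Membership.Propositional using (_∈_)
open import Data.List.Membership.Propositional.Properties using (∈-map⁻)
open import Data.List.Relation.Unary.Any using (here; there)
open import Data.List.Relation.Binary.Permutation.Propositional using (↭-sym)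
open import Data.List.Relation.Binary.Permutation.Propositional.Properties using (∈-resp-↭)
open import Data.Product using (_,_)
open import Relation.Binary.PropositionalEquality using (refl)

⊓∞-≤ʳ : ∀ m x → m ⊓∞ x ≤ x
⊓∞-≤ʳ (fin p) x = p⊓q≤q p x
⊓∞-≤ʳ ∞       x = ≤-refl

1+nonNeg : ∀ {ε} → 0ℚ ≤ ε → NonNegative (1ℚ + ε)
1+nonNeg ε≥0 = nonNegative (+-mono-≤ (nonNegative⁻¹ 1ℚ) ε≥0)

module _ (G : WGraph) where

  -- M (node a b) ≡ fin (minMerge a b)
  minMerge : Tree G → Tree G → ℚ
  minMerge a b = M G a ⊓∞ (M G b ⊓∞ wT G a b)

  minMerge-≤-wT : ∀ a b → minMerge a b ≤ wT G a b
  minMerge-≤-wT a b = ≤-trans (⊓∞-≤ʳ (M G a) _) (⊓∞-≤ʳ (M G b) _)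

  minMerge-≤-⊑ : ∀ {l r a b} → _⊑_ G (node l r) (node a b) → minMerge a b ≤ wT G l r
  minMerge-≤-⊑ {a = a} {b} ⊑-refl = minMerge-≤-wT a b
  minMerge-≤-⊑ {a = node a₁ a₂} (⊑-l l⊑a) =
    ≤-trans (p⊓q≤p (minMerge a₁ a₂) _) (minMerge-≤-⊑ l⊑a)
  minMerge-≤-⊑ {a = a} {node b₁ b₂} (⊑-r l⊑b) =
    ≤-trans (⊓∞-≤ʳ (M G a) _) (≤-trans (p⊓q≤p (minMerge b₁ b₂) _) (minMerge-≤-⊑ l⊑b))

  good⇒wT-≤ : ∀ ε u v rest → Good G ε u v rest → wT G u v ≤ (1ℚ + ε) * minMerge u v
  good⇒wT-≤ ε u v rest good = ≤-trans (p≤p⊔q _ _) (≤-trans (p≤p⊔q _ _) good)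

  GoodTree : ℚ → Tree G → Set
  GoodTree ε T = ∀ {a b} → _⊑_ G (node a b) T → wT G a b ≤ (1ℚ + ε) * minMerge a b

  goodRun⇒goodTree : ∀ {ε D} → GoodRun G ε D → ∀ {T} → T ∈ D → GoodTree ε T
  goodRun⇒goodTree start T∈ _ with ∈-map⁻ leaf T∈
  goodRun⇒goodTree start T∈ () | _ , _ , refl
  goodRun⇒goodTree {ε} (merge u v rest R σ _ good) (here refl) ⊑-refl =
    good⇒wT-≤ ε u v rest good
  goodRun⇒goodTree (merge u v rest R σ _ _) (here refl) (⊑-l ab⊑u) =
    goodRun⇒goodTree R (∈-resp-↭ (↭-sym σ) (here refl)) ab⊑u
  goodRun⇒goodTree (merge u v rest R σ _ _) (here refl) (⊑-r ab⊑v) =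
    goodRun⇒goodTree R (∈-resp-↭ (↭-sym σ) (there (here refl))) ab⊑v
  goodRun⇒goodTree (merge u v rest R σ _ _) (there T∈) ab⊑T =
    goodRun⇒goodTree R (∈-resp-↭ (↭-sym σ) (there (there T∈))) ab⊑T

  flat⇒⊑ : ∀ {t T d} → Flat G t T d → _⊑_ G d T
  flat⇒⊑ (here _)    = ⊑-refl
  flat⇒⊑ (left _ f)  = ⊑-l (flat⇒⊑ f)
  flat⇒⊑ (right _ f) = ⊑-r (flat⇒⊑ f)

  flat⇒≤linkage : ∀ {t T d} → Flat G t T d → t ≤∞ linkage G d
  flat⇒≤linkage (here t≤)   = t≤
  flat⇒≤linkage (left _ f)  = flat⇒≤linkage f
  flat⇒≤linkage (right _ f) = flat⇒≤linkage f

lemma4p5 : (G : WGraph) (ε : ℚ) → 0ℚ ≤ ε → (D : List (Tree G)) → GoodRun G ε D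
         → (t : ℚ) → ∀ {T d} → T ∈ D → Flat G t T d
         → ∀ {l r} → _⊑_ G (node l r) d → t ≤ (1ℚ + ε) * wT G l r
lemma4p5 G ε ε≥0 D R t {d = leaf _} T∈ F ()
lemma4p5 G ε ε≥0 D R t {d = node _ _} T∈ F lr⊑d =
  ≤-trans (flat⇒≤linkage G F)
    (≤-trans (goodRun⇒goodTree G R T∈ (flat⇒⊑ G F))
      (*-monoˡ-≤-nonNeg (1ℚ + ε) {{1+nonNeg ε≥0}} (minMerge-≤-⊑ G lr⊑d)))
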